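{- Every (untyped) $\lambda\mu$T-term $t$ is in $\mathrm{SN}_B$, i.e. is strongly normalizing with respect to $\to_B$.
   Context: $\lambda\mu$T raw terms/commands: $t ::= x\mid\lambda x.r\mid ts\mid\mu\alpha.c\mid0\mid\mathsf S\,t\mid\mathsf{nrec}\ r\ s\ t$, $c::=[\alpha]t$ ($x$ $\lambda$-variables, $\alpha$ $\mu$-variables); $\mathrm{FCV}$: free $\mu$-variables. $c[\beta:=\alpha\,\Box]$ denotes replacing every subcommand $[\beta]q$ of $c$ by $[\alpha]q'$, where $q'$ is $q$ with the same replacement applied (i.e. renaming the free $\mu$-variable $\beta$ to $\alpha$). $\to_B$ is the compatible closure (on terms and commands) of $\mu\alpha.[\alpha]t\to t$ if $\alpha\notin\mathrm{FCV}(t)$, and $[\alpha]\mu\beta.c\to c[\beta:=\alpha\,\Box]$. $\mathrm{SN}_B$ is the inductively defined set: $t\in\mathrm{SN}_B$ if every $t'$ with $t\to_B t'$ lies in $\mathrm{SN}_B$. -}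

module Defs where

open import Data.Nat using (ℕ; zero; suc)
open import Relation.Binary.PropositionalEquality using (_≡_)
open import Relation.Nullary using (¬_)

-- Raw λμT terms and commands, in de Bruijn notation (terms modulo α).
-- Two separate namespaces: λ-variables (bound by lam) and μ-variables
-- (bound by mu).  var n  is the λ-variable with index n;
-- named α t  is the command [α]t with μ-variable index α.
mutual
  data Term : Set where
    var  : ℕ → Term
    lam  : Term → Term
    app  : Term → Term → Term
    mu   : Cmd → Term
    zer  : Term
    succ : Term → Term
    nrec : Term → Term → Term → Term

  data Cmd : Set where
    named : ℕ → Term → Cmd

liftR : (ℕ → ℕ) → ℕ → ℕ
liftR ρ zero    = zero
liftR ρ (suc n) = suc (ρ n)

mutual
  renT : (ℕ → ℕ) → Term → Term
  renT ρ (var x)      = var x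
  renT ρ (lam r)      = lam (renT ρ r)
  renT ρ (app t s)    = app (renT ρ t) (renT ρ s)
  renT ρ (mu c)       = mu (renC (liftR ρ) c)
  renT ρ zer          = zer
  renT ρ (succ t)     = succ (renT ρ t)
  renT ρ (nrec r s t) = nrec (renT ρ r) (renT ρ s) (renT ρ t)

  renC : (ℕ → ℕ) → Cmd → Cmd
  renC ρ (named α t) = named (ρ α) (renT ρ t)

mutual
  data _∈FCVₜ_ (α : ℕ) : Term → Set where
    lam   : ∀ {r} → α ∈FCVₜ r → α ∈FCVₜ lam r
    appₗ  : ∀ {t s} → α ∈FCVₜ t → α ∈FCVₜ app t s
    appᵣ  : ∀ {t s} → α ∈FCVₜ s → α ∈FCVₜ app t s
    mu    : ∀ {c} → suc α ∈FCVc c → α ∈FCVₜ mu c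
    succ  : ∀ {t} → α ∈FCVₜ t → α ∈FCVₜ succ t
    nrec₁ : ∀ {r s t} → α ∈FCVₜ r → α ∈FCVₜ nrec r s t
    nrec₂ : ∀ {r s t} → α ∈FCVₜ s → α ∈FCVₜ nrec r s t
    nrec₃ : ∀ {r s t} → α ∈FCVₜ t → α ∈FCVₜ nrec r s t

  data _∈FCVc_ (α : ℕ) : Cmd → Set where
    here  : ∀ {β t} → α ≡ β → α ∈FCVc named β t
    there : ∀ {β t} → α ∈FCVₜ t → α ∈FCVc named β t

-- substitution for the binder just removed:  0 ↦ α,  n+1 ↦ n
-- (realises c[β:=α□] for  [α]μβ.c  in de Bruijn form)
rename0 : ℕ → ℕ → ℕ
rename0 α zero    = α
rename0 α (suc n) = n

-- predecessor: removes an unused μ-binder (index 0 does not occur)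
down : ℕ → ℕ
down zero    = zero
down (suc n) = n

mutual
  data _→Bₜ_ : Term → Term → Set where
    -- μα.[α]t → t   if α ∉ FCV(t)
    ruleμ  : ∀ {t} → ¬ (zero ∈FCVₜ t) → mu (named zero t) →Bₜ renT down t
    lam    : ∀ {r r'} → r →Bₜ r' → lam r →Bₜ lam r'
    appₗ   : ∀ {t t' s} → t →Bₜ t' → app t s →Bₜ app t' s
    appᵣ   : ∀ {t s s'} → s →Bₜ s' → app t s →Bₜ app t s'
    mu     : ∀ {c c'} → c →Bc c' → mu c →Bₜ mu c'
    succ   : ∀ {t t'} → t →Bₜ t' → succ t →Bₜ succ t'
    nrec₁  : ∀ {r r' s t} → r →Bₜ r' → nrec r s t →Bₜ nrec r' s t
    nrec₂  : ∀ {r s s' t} → s →Bₜ s' → nrec r s t →Bₜ nrec r s' t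
    nrec₃  : ∀ {r s t t'} → t →Bₜ t' → nrec r s t →Bₜ nrec r s t'

  data _→Bc_ : Cmd → Cmd → Set where
    -- [α]μβ.c → c[β:=α□]
    ruleR  : ∀ {α c} → named α (mu c) →Bc renC (rename0 α) c
    named  : ∀ {α t t'} → t →Bₜ t' → named α t →Bc named α t'

data SN-B (t : Term) : Set where
  sn : (∀ t' → t →Bₜ t' → SN-B t') → SN-B t

module Submission where

-- Neither B-rule duplicates or creates material: the rule
-- μα.[α]t → t deletes one μ-binder and only renames μ-variables of t, and
-- [α]μβ.c → c[β:=α□] likewise deletes one μ-binder and renames.  Hence
-- the number of μ-binders in a term, #μ, is invariant under μ-renaming
-- and strictly decreases along every →B step (contextual closure only adds
-- the same amount on both sides).  A relation along which a ℕ-valued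
-- measure strictly decreases is strongly normalising, by well-founded
-- induction on the measure.

open import Defs
open import Data.Nat using (ℕ; suc; _+_; _<_; s≤s)
open import Data.Nat.Properties using (+-monoˡ-<; +-monoʳ-<; n<1+n)
open import Data.Nat.Induction using (<-wellFounded)
open import Induction.WellFounded using (Acc; acc)
open import Relation.Binary.PropositionalEquality using (_≡_; refl; cong; cong₂)

mutual
  #μ : Term → ℕ
  #μ (var x)      = 0
  #μ (lam r)      = #μ r
  #μ (app t s)    = #μ t + #μ s
  #μ (mu c)       = suc (#μᶜ c)
  #μ zer          = 0
  #μ (succ t)     = #μ t
  #μ (nrec r s t) = #μ r + (#μ s + #μ t)

  #μᶜ : Cmd → ℕ
  #μᶜ (named α t) = #μ t

mutual
  #μ-renT : ∀ ρ t → #μ (renT ρ t) ≡ #μ t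
  #μ-renT ρ (var x)      = refl
  #μ-renT ρ (lam r)      = #μ-renT ρ r
  #μ-renT ρ (app t s)    = cong₂ _+_ (#μ-renT ρ t) (#μ-renT ρ s)
  #μ-renT ρ (mu c)       = cong suc (#μ-renC (liftR ρ) c)
  #μ-renT ρ zer          = refl
  #μ-renT ρ (succ t)     = #μ-renT ρ t
  #μ-renT ρ (nrec r s t) =
    cong₂ _+_ (#μ-renT ρ r) (cong₂ _+_ (#μ-renT ρ s) (#μ-renT ρ t))

  #μ-renC : ∀ ρ c → #μᶜ (renC ρ c) ≡ #μᶜ c
  #μ-renC ρ (named α t) = #μ-renT ρ t

-- A contractum with as many μ-binders as the body of a removed μ-binder
-- is strictly smaller than the redex.
renamed-body-smaller : ∀ {m n} → m ≡ n → m < suc n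
renamed-body-smaller refl = n<1+n _

-- Both B-rules remove exactly one μ-binder (the contractum is a renaming of
-- the body), and the remaining cases are monotonicity of + and suc.
mutual
  #μ-decreasesₜ : ∀ {t t'} → t →Bₜ t' → #μ t' < #μ t
  #μ-decreasesₜ {mu (named _ t)} (ruleμ _) = renamed-body-smaller (#μ-renT down t)
  #μ-decreasesₜ (lam p)  = #μ-decreasesₜ p
  #μ-decreasesₜ {app t s} (appₗ p) = +-monoˡ-< (#μ s) (#μ-decreasesₜ p)
  #μ-decreasesₜ {app t s} (appᵣ p) = +-monoʳ-< (#μ t) (#μ-decreasesₜ p)
  #μ-decreasesₜ (mu p)   = s≤s (#μ-decreasesᶜ p)
  #μ-decreasesₜ (succ p) = #μ-decreasesₜ p
  #μ-decreasesₜ {nrec r s t} (nrec₁ p) =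
    +-monoˡ-< (#μ s + #μ t) (#μ-decreasesₜ p)
  #μ-decreasesₜ {nrec r s t} (nrec₂ p) =
    +-monoʳ-< (#μ r) (+-monoˡ-< (#μ t) (#μ-decreasesₜ p))
  #μ-decreasesₜ {nrec r s t} (nrec₃ p) =
    +-monoʳ-< (#μ r) (+-monoʳ-< (#μ s) (#μ-decreasesₜ p))

  #μ-decreasesᶜ : ∀ {c c'} → c →Bc c' → #μᶜ c' < #μᶜ c
  #μ-decreasesᶜ {named α (mu c)} ruleR =
    renamed-body-smaller (#μ-renC (rename0 α) c)
  #μ-decreasesᶜ (named p) = #μ-decreasesₜ p

measure-decreasing⇒SN : (f : Term → ℕ) →
                        (∀ {t t'} → t →Bₜ t' → f t' < f t) →
                        ∀ t → SN-B t
measure-decreasing⇒SN f decreasing t = sn-from-acc t (<-wellFounded (f t))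
  where
  sn-from-acc : ∀ u → Acc _<_ (f u) → SN-B u
  sn-from-acc u (acc smaller) =
    sn λ u' u→u' → sn-from-acc u' (smaller (decreasing u→u'))

lemma6p30 : (t : Term) → SN-B t
lemma6p30 = measure-decreasing⇒SN #μ #μ-decreasesₜ
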